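{- (1) For all integers $n\ge16$ and $i\ge7$: (a) $16n^2\le f_i(n)$; (b) $f_i(16n^2)\le f_i^{(2)}(n)$. (2) For all integers $i\ge1$ and $n\ge16$, $A_i(n)\le f_{i+6}^{(2)}(n)$.
   Context: For a function $f:\mathbb N\to\mathbb N$, $f^{(0)}(x)=x$ and $f^{(n+1)}(x)=f(f^{(n)}(x))$. Define $f_i:\mathbb N\to\mathbb N$ for $i\ge1$ by $f_1(n)=n+1$ and $f_{i+1}(n)=f_i^{(\lfloor\sqrt n/2\rfloor)}(n)$. Define $A_i:\mathbb N\to\mathbb N$ for $i\ge1$ by $A_1(n)=n+1$ and $A_{i+1}(n)=A_i^{(n)}(n)$. -}

module Defs where

open import Data.Nat using (ℕ; zero; suc; _+_; _*_; _≤ᵇ_)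
open import Data.Nat.DivMod using (_/_)
open import Data.Bool using (if_then_else_)

iter : (ℕ → ℕ) → ℕ → ℕ → ℕ
iter f zero    x = x
iter f (suc n) x = f (iter f n x)

isqrt : ℕ → ℕ
isqrt zero = 0
isqrt (suc n) with isqrt n
... | s = if (suc s * suc s) ≤ᵇ suc n then suc s else s

-- ⌊√n / 2⌋ = ⌊⌊√n⌋ / 2⌋
halfSqrt : ℕ → ℕ
halfSqrt n = isqrt n / 2

-- f i n  =  f_{i+1}(n)  (0-indexed internally: f 0 = f_1)
fAux : ℕ → ℕ → ℕ
fAux zero    n = suc n
fAux (suc i) n = iter (fAux i) (halfSqrt n) n

-- paper's f_i for i ≥ 1 (f 0 is junk, set to f_1)
f : ℕ → ℕ → ℕ
f zero    = fAux 0
f (suc i) = fAux i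

AAux : ℕ → ℕ → ℕ
AAux zero    n = suc n
AAux (suc i) n = iter (AAux i) n n

A : ℕ → ℕ → ℕ
A zero    = AAux 0
A (suc i) = AAux i

{-# OPTIONS --safe #-}
module Submission where

-- Each of the ⌊√x/2⌋ iterations of f_i in f_{i+1}(x) adds at least ⌊√x/2⌋^(i-1), so
-- f_{i+1}(x) ≥ x + ⌊√x/2⌋^i. For n ≥ 16384, j = ⌊√n/2⌋ ≥ 64 and n ≤ 16j², so
-- 16n² ≤ 64²j⁴ ≤ j⁶ ≤ f_7(n); the remaining n are handled by monotonicity and a certified
-- lower bound for f_7(16). Part (1b) is (1a) plus monotonicity. For (2), induct on i with
-- g = f_{i+6}: from A_i ≤ g∘g on [16,∞), A_{i+1}(n) = A_i^(n)(n) ≤ g^(2n)(n) ≤ g^(2n)(m)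
-- with m = f_{i+7}(n) ≥ 16n², and since 2n ≤ ⌊√m/2⌋ this is at most
-- g^(⌊√m/2⌋)(m) = f_{i+7}(m).

open import Defs
open import Data.Nat using (ℕ; zero; suc; _+_; _*_; _∸_; _^_; _/_; _≤_; _<_; _≤′_; ≤′-refl; ≤′-step; _≤ᵇ_; z≤n; s≤s; _≤?_; NonZero)
open import Data.Nat.Properties
open import Data.Nat.DivMod using (m*n/n≡m; /-monoˡ-≤)
open import Data.Nat.Tactic.RingSolver using (solve-∀)
open import Data.Bool using (true; false; T)
open import Data.Unit using (tt)
open import Data.Product using (_×_; _,_)
open import Function using (_∘_)
open import Relation.Binary.PropositionalEquality using (_≡_; refl; sym; cong; subst)
open import Relation.Nullary using (yes; no)

-- Not _Preserves_⟶_, whose unfolding through `on` makes the type checker normalise fAux at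
-- the concrete arguments in B≤fAux6-16.
Monotone : (ℕ → ℕ) → Set
Monotone g = ∀ {x y} → x ≤ y → g x ≤ g y

Inflationary : (ℕ → ℕ) → Set
Inflationary g = ∀ x → x ≤ g x

m<[1+m/n]*n : ∀ m n .{{_ : NonZero n}} → m < suc (m / n) * n
m<[1+m/n]*n m n = ≰⇒> λ le →
  n≮n (m / n) (subst (_≤ m / n) (m*n/n≡m (suc (m / n)) n) (/-monoˡ-≤ n le))

isqrt²≤ : ∀ n → isqrt n * isqrt n ≤ n
isqrt²≤ zero = z≤n
isqrt²≤ (suc n) with isqrt n | isqrt²≤ n
... | s | s²≤n with (suc s * suc s) ≤ᵇ suc n in eq
...   | true  = ≤ᵇ⇒≤ (suc s * suc s) (suc n) (subst T (sym eq) tt)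
...   | false = m≤n⇒m≤1+n s²≤n

<[1+isqrt]² : ∀ n → n < suc (isqrt n) * suc (isqrt n)
<[1+isqrt]² zero = s≤s z≤n
<[1+isqrt]² (suc n) with isqrt n | <[1+isqrt]² n
... | s | n<[1+s]² with (suc s * suc s) ≤ᵇ suc n in eq
...   | true  = ≤-<-trans n<[1+s]² (*-mono-< (n<1+n (suc s)) (n<1+n (suc s)))
...   | false = ≰⇒> λ le → subst T eq (≤⇒≤ᵇ le)

isqrt-greatest : ∀ {k n} → k * k ≤ n → k ≤ isqrt n
isqrt-greatest {k} {n} k²≤n = ≮⇒≥ λ s<k →
  <⇒≱ (<[1+isqrt]² n) (≤-trans (*-mono-≤ s<k s<k) k²≤n)

isqrt-mono-≤ : Monotone isqrt
isqrt-mono-≤ {m} m≤n = isqrt-greatest (≤-trans (isqrt²≤ m) m≤n)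

halfSqrt-greatest : ∀ {j n} → 4 * (j * j) ≤ n → j ≤ halfSqrt n
halfSqrt-greatest {j} {n} 4j²≤n = subst (_≤ halfSqrt n) (m*n/n≡m j 2)
  (/-monoˡ-≤ 2 (isqrt-greatest {j * 2} (subst (_≤ n) (double² j) 4j²≤n)))
  where
  double² : ∀ j → 4 * (j * j) ≡ (j * 2) * (j * 2)
  double² = solve-∀

halfSqrt-mono-≤ : Monotone halfSqrt
halfSqrt-mono-≤ = /-monoˡ-≤ 2 ∘ isqrt-mono-≤

≤16*halfSqrt² : ∀ {n} → 1 ≤ halfSqrt n → n ≤ 16 * (halfSqrt n * halfSqrt n)
≤16*halfSqrt² {n} 1≤j = begin
  n                                 ≤⟨ <⇒≤ (<[1+isqrt]² n) ⟩
  suc (isqrt n) * suc (isqrt n)     ≤⟨ *-mono-≤ 1+s≤[1+j]*2 1+s≤[1+j]*2 ⟩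
  (suc j * 2) * (suc j * 2)         ≤⟨ *-mono-≤ 1+j≤j+j 1+j≤j+j ⟩
  ((j + j) * 2) * ((j + j) * 2)     ≡⟨ quadruple² j ⟩
  16 * (j * j)                      ∎
  where
  open ≤-Reasoning
  j = halfSqrt n
  1+s≤[1+j]*2 = m<[1+m/n]*n (isqrt n) 2
  1+j≤j+j = *-monoˡ-≤ 2 (+-monoˡ-≤ j 1≤j)
  quadruple² : ∀ j → ((j + j) * 2) * ((j + j) * 2) ≡ 16 * (j * j)
  quadruple² = solve-∀

iter-+ : ∀ (g : ℕ → ℕ) m n x → iter g (m + n) x ≡ iter g m (iter g n x)
iter-+ g zero    n x = refl
iter-+ g (suc m) n x = cong g (iter-+ g m n x)

iter-inflationary : ∀ {g} → Inflationary g → ∀ t → Inflationary (iter g t)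
iter-inflationary g-infl zero    x = ≤-refl
iter-inflationary {g} g-infl (suc t) x =
  ≤-trans (iter-inflationary g-infl t x) (g-infl (iter g t x))

iter-mono-≤ : ∀ {g} → Monotone g → ∀ t → Monotone (iter g t)
iter-mono-≤ g-mono zero    x≤y = x≤y
iter-mono-≤ g-mono (suc t) x≤y = g-mono (iter-mono-≤ g-mono t x≤y)

iter-steps-mono-≤ : ∀ {g} → Inflationary g → ∀ {s t} → s ≤ t → ∀ x → iter g s x ≤ iter g t x
iter-steps-mono-≤ {g} g-infl {s} {t} s≤t x = begin
  iter g s x                  ≤⟨ iter-inflationary g-infl (t ∸ s) (iter g s x) ⟩
  iter g (t ∸ s) (iter g s x) ≡⟨ iter-+ g (t ∸ s) s x ⟨
  iter g (t ∸ s + s) x        ≡⟨ cong (λ k → iter g k x) (m∸n+n≡m s≤t) ⟩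
  iter g t x                  ∎
  where open ≤-Reasoning

iter-additive-growth : ∀ {g φ} → Monotone φ → (∀ x → x + φ x ≤ g x) →
                       ∀ t x → x + t * φ x ≤ iter g t x
iter-additive-growth φ-mono growth zero x = ≤-reflexive (+-identityʳ x)
iter-additive-growth {g} {φ} φ-mono growth (suc t) x = begin
  x + (φ x + t * φ x) ≡⟨ swap x (φ x) (t * φ x) ⟩
  x + t * φ x + φ x   ≤⟨ +-mono-≤ ih (φ-mono (≤-trans (m≤m+n x (t * φ x)) ih)) ⟩
  y + φ y             ≤⟨ growth y ⟩
  g y                 ∎
  where
  open ≤-Reasoning
  y = iter g t x
  ih = iter-additive-growth φ-mono growth t x
  swap : ∀ a b c → a + (b + c) ≡ a + c + b
  swap = solve-∀

iter-simulation : ∀ {g G c k} → Inflationary g → Monotone G →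
                  (∀ y → c ≤ y → g y ≤ iter G k y) →
                  ∀ t {x} → c ≤ x → iter g t x ≤ iter G (t * k) x
iter-simulation g-infl G-mono g≤Gᵏ zero    c≤x = ≤-refl
iter-simulation {g} {G} {c} {k} g-infl G-mono g≤Gᵏ (suc t) {x} c≤x = begin
  g (iter g t x)              ≤⟨ g≤Gᵏ (iter g t x) (≤-trans c≤x (iter-inflationary g-infl t x)) ⟩
  iter G k (iter g t x)       ≤⟨ iter-mono-≤ G-mono k (iter-simulation g-infl G-mono g≤Gᵏ t c≤x) ⟩
  iter G k (iter G (t * k) x) ≡⟨ iter-+ G k (t * k) x ⟨
  iter G (k + t * k) x        ∎
  where open ≤-Reasoning

iter-≥-chain : ∀ {g} (a : ℕ → ℕ) t → (∀ k {y} → k < t → a k ≤ y → a (suc k) ≤ g y) →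
               ∀ {x} → a 0 ≤ x → a t ≤ iter g t x
iter-≥-chain a zero    step a₀≤x = a₀≤x
iter-≥-chain a (suc t) step a₀≤x =
  step t ≤-refl (iter-≥-chain a t (λ k k<t → step k (m≤n⇒m≤1+n k<t)) a₀≤x)

fAux-growth : ∀ i x → x + halfSqrt x ^ i ≤ fAux i x
fAux-growth zero    x = ≤-reflexive (+-comm x 1)
fAux-growth (suc i) x =
  iter-additive-growth (^-monoˡ-≤ i ∘ halfSqrt-mono-≤) (fAux-growth i) (halfSqrt x) x

fAux-inflationary : ∀ i → Inflationary (fAux i)
fAux-inflationary i x = ≤-trans (m≤m+n x _) (fAux-growth i x)

iter≤fAux-suc : ∀ i {k x} → k ≤ halfSqrt x → iter (fAux i) k x ≤ fAux (suc i) x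
iter≤fAux-suc i {x = x} k≤h = iter-steps-mono-≤ (fAux-inflationary i) k≤h x

fAux-mono-≤ : ∀ i → Monotone (fAux i)
fAux-mono-≤ zero    = s≤s
fAux-mono-≤ (suc i) {x} {y} x≤y =
  ≤-trans (iter-mono-≤ (fAux-mono-≤ i) (halfSqrt x) x≤y)
          (iter≤fAux-suc i (halfSqrt-mono-≤ x≤y))

fAux-index-mono-≤ : ∀ {x} → 4 ≤ x → ∀ {i k} → i ≤ k → fAux i x ≤ fAux k x
fAux-index-mono-≤ {x} 4≤x = step* ∘ ≤⇒≤′
  where
  step* : ∀ {i k} → i ≤′ k → fAux i x ≤ fAux k x
  step* ≤′-refl            = ≤-refl
  step* (≤′-step {k} i≤′k) = ≤-trans (step* i≤′k) (iter≤fAux-suc k (halfSqrt-greatest {1} 4≤x))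

fAux-certified-growth : ∀ i j {a y} → 4 * (j * j) ≤ a → a ≤ y → a + j ^ i ≤ fAux i y
fAux-certified-growth i j {y = y} 4j²≤a a≤y = ≤-trans
  (+-mono-≤ a≤y (^-monoˡ-≤ i (≤-trans (halfSqrt-greatest 4j²≤a) (halfSqrt-mono-≤ a≤y))))
  (fAux-growth i y)

-- B bounds 16n² for the n not covered by 16n²≤fAux6-large. We use f_7(16) = f_6^(2)(16),
-- f_6(16) = 74 and f_6(74) = f_5^(4)(74). Normalising f_6(74) is infeasible, so every type
-- comparison at concrete arguments must be syntactic: hence the explicit implicit arguments
-- and the indices written suc 4 and suc (suc 4) rather than 5 and 6.
B : ℕ
B = 16 * (16383 * 16383)

B≤fAux5-74 : B ≤ fAux (suc 4) 74
B≤fAux5-74 = begin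
  B                    ≤⟨ ≤ᵇ⇒≤ B (bound 4) tt ⟩
  bound 4              ≤⟨ iter-≥-chain {fAux 4} bound 4 step {74} ≤-refl ⟩
  iter (fAux 4) 4 74   ≤⟨ iter≤fAux-suc 4 {4} {74} ≤-refl ⟩
  fAux (suc 4) 74      ∎
  where
  open ≤-Reasoning
  bound : ℕ → ℕ
  bound 0 = 74
  bound 1 = 330
  bound 2 = 6891
  bound 3 = 2832652
  bound _ = 2832652 + 841 ^ 4
  cert : ∀ j {a y} → T (4 * (j * j) ≤ᵇ a) → a ≤ y → a + j ^ 4 ≤ fAux 4 y
  cert j {a} 4j²≤a = fAux-certified-growth 4 j (≤ᵇ⇒≤ _ a 4j²≤a)
  step : ∀ k {y} → k < 4 → bound k ≤ y → bound (suc k) ≤ fAux 4 y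
  step 0 _ = cert 4 tt
  step 1 _ = cert 9 tt
  step 2 _ = cert 41 tt
  step 3 _ = cert 841 tt
  step (suc (suc (suc (suc _)))) (s≤s (s≤s (s≤s (s≤s ()))))

B≤fAux6-16 : B ≤ fAux (suc (suc 4)) 16
B≤fAux6-16 = begin
  B                          ≤⟨ iter-≥-chain {fAux (suc 4)} bound 2 step {16} ≤-refl ⟩
  iter (fAux (suc 4)) 2 16   ≤⟨ iter≤fAux-suc (suc 4) {2} {16} ≤-refl ⟩
  fAux (suc (suc 4)) 16      ∎
  where
  open ≤-Reasoning
  bound : ℕ → ℕ
  bound 0 = 16
  bound 1 = 74
  bound _ = B
  step : ∀ k {y} → k < 2 → bound k ≤ y → bound (suc k) ≤ fAux (suc 4) y
  step 0 _ 16≤y = fAux-mono-≤ (suc 4) {16} 16≤y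
  step 1 _ 74≤y = ≤-trans B≤fAux5-74 (fAux-mono-≤ (suc 4) {74} 74≤y)
  step (suc (suc _)) (s≤s (s≤s ()))

16n²≤fAux6-large : ∀ {n} → 16384 ≤ n → 16 * (n * n) ≤ fAux 6 n
16n²≤fAux6-large {n} 16384≤n = begin
  16 * (n * n)                             ≤⟨ *-monoʳ-≤ 16 (*-mono-≤ n≤16j² n≤16j²) ⟩
  16 * ((16 * (j * j)) * (16 * (j * j)))   ≡⟨ regroup j ⟩
  (64 * 64) * ((j * j) * (j * j))          ≤⟨ *-monoˡ-≤ ((j * j) * (j * j)) (*-mono-≤ 64≤j 64≤j) ⟩
  (j * j) * ((j * j) * (j * j))            ≡⟨ sixth-power j ⟩
  j ^ 6                                    ≤⟨ m≤n+m (j ^ 6) n ⟩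
  n + j ^ 6                                ≤⟨ fAux-growth 6 n ⟩
  fAux 6 n                                 ∎
  where
  open ≤-Reasoning
  j = halfSqrt n
  64≤j : 64 ≤ j
  64≤j = halfSqrt-greatest {64} 16384≤n
  n≤16j² : n ≤ 16 * (j * j)
  n≤16j² = ≤16*halfSqrt² {n} (≤-trans (s≤s z≤n) 64≤j)
  regroup : ∀ x → 16 * ((16 * (x * x)) * (16 * (x * x))) ≡ (64 * 64) * ((x * x) * (x * x))
  regroup = solve-∀
  sixth-power : ∀ x → (x * x) * ((x * x) * (x * x)) ≡ x * (x * (x * (x * (x * (x * 1)))))
  sixth-power = solve-∀

16n²≤fAux6-small : ∀ {n} → 16 ≤ n → n ≤ 16383 → 16 * (n * n) ≤ fAux 6 n
16n²≤fAux6-small {n} 16≤n n≤16383 = begin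
  16 * (n * n)               ≤⟨ *-monoʳ-≤ 16 (*-mono-≤ n≤16383 n≤16383) ⟩
  B                          ≤⟨ B≤fAux6-16 ⟩
  fAux (suc (suc 4)) 16      ≤⟨ fAux-mono-≤ (suc (suc 4)) {16} {n} 16≤n ⟩
  fAux 6 n                   ∎
  where open ≤-Reasoning

16n²≤fAux : ∀ {n i} → 16 ≤ n → 6 ≤ i → 16 * (n * n) ≤ fAux i n
16n²≤fAux {n} 16≤n 6≤i = ≤-trans 16n²≤fAux6 (fAux-index-mono-≤ (≤-trans (m≤n+m 4 12) 16≤n) 6≤i)
  where
  16n²≤fAux6 : 16 * (n * n) ≤ fAux 6 n
  16n²≤fAux6 with 16384 ≤? n
  ... | yes large = 16n²≤fAux6-large large
  ... | no  small = 16n²≤fAux6-small 16≤n (≤-pred (≰⇒> small))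

AAux-inflationary : ∀ k → Inflationary (AAux k)
AAux-inflationary zero    = n≤1+n
AAux-inflationary (suc k) x = iter-inflationary (AAux-inflationary k) x x

AAux≤fAux² : ∀ k {n} → 16 ≤ n → AAux k n ≤ iter (fAux (k + 6)) 2 n
AAux≤fAux² zero {n} 16≤n = begin
  suc n              ≤⟨ fAux-index-mono-≤ (≤-trans (m≤n+m 4 12) 16≤n) {0} {6} z≤n ⟩
  fAux 6 n           ≤⟨ fAux-inflationary 6 (fAux 6 n) ⟩
  fAux 6 (fAux 6 n)  ∎
  where open ≤-Reasoning
AAux≤fAux² (suc k) {n} 16≤n = begin
  iter (AAux k) n n              ≤⟨ iter-simulation (AAux-inflationary k) (fAux-mono-≤ (k + 6))
                                                    (λ _ → AAux≤fAux² k) n 16≤n ⟩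
  iter (fAux (k + 6)) (n * 2) n  ≤⟨ iter-mono-≤ (fAux-mono-≤ (k + 6)) (n * 2) n≤m ⟩
  iter (fAux (k + 6)) (n * 2) m  ≤⟨ iter≤fAux-suc (k + 6) 2n≤halfSqrt-m ⟩
  fAux (suc (k + 6)) m           ∎
  where
  open ≤-Reasoning
  m = fAux (suc (k + 6)) n
  n≤m = fAux-inflationary (suc (k + 6)) n
  16n²≤m : 16 * (n * n) ≤ m
  16n²≤m = 16n²≤fAux 16≤n (m≤n⇒m≤1+n (m≤n+m 6 k))
  double² : ∀ n → 4 * ((n * 2) * (n * 2)) ≡ 16 * (n * n)
  double² = solve-∀
  2n≤halfSqrt-m : n * 2 ≤ halfSqrt m
  2n≤halfSqrt-m = halfSqrt-greatest (≤-trans (≤-reflexive (double² n)) 16n²≤m)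

mainTheorem5 : ((n i : ℕ) → 16 ≤ n → 7 ≤ i →
    (16 * (n * n) ≤ f i n) × (f i (16 * (n * n)) ≤ iter (f i) 2 n))
    × ((i n : ℕ) → 1 ≤ i → 16 ≤ n → A i n ≤ iter (f (i + 6)) 2 n)
mainTheorem5 = part1 , part2
  where
  part1 : (n i : ℕ) → 16 ≤ n → 7 ≤ i →
    (16 * (n * n) ≤ f i n) × (f i (16 * (n * n)) ≤ iter (f i) 2 n)
  part1 n (suc i) 16≤n (s≤s 6≤i) = 16n²≤fᵢn , fAux-mono-≤ i 16n²≤fᵢn
    where 16n²≤fᵢn = 16n²≤fAux 16≤n 6≤i
  part2 : (i n : ℕ) → 1 ≤ i → 16 ≤ n → A i n ≤ iter (f (i + 6)) 2 n
  part2 (suc k) n _ 16≤n = AAux≤fAux² k 16≤n
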